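{- Let $K$ be a field and let $f$ be a hypergeometric term on $\mathbb{Z}^k$ over $K$ that is weakly factorial on a polyhedral region $\mathcal R$. Then there exist finitely many polyhedral regions $\mathcal R_1,\ldots,\mathcal R_m$ with $\mathcal R=\mathcal R_1\cup\cdots\cup\mathcal R_m$ such that $f$ is factorial on each $\mathcal R_i$.
   Context: $\mathbf e_i$ is the $i$-th unit vector. A hypergeometric term on $\mathbb{Z}^k$ over $K$ is a function $f\colon\mathbb{Z}^k\to K$ such that for each $i$ there are nonzero $A_i,B_i\in K[\mathbf z]$ with $A_i(\mathbf z)f(\mathbf z)=B_i(\mathbf z)f(\mathbf z+\mathbf e_i)$ for all $\mathbf z$. A half-space in $\mathbb{Z}^k$ is $\{\mathbf z:\mathbf v\cdot\mathbf z>n\}$ ($\mathbf v\in\mathbb{Z}^k$, $n\in\mathbb{Z}$); a region is polyhedral if it is $\mathbb{Z}^k$ or a finite intersection of half-spaces. For integers $a,b$: $\operatorname{GP}_{j=a}^{b}F(j)=\prod_{j=a}^{b-1}F(j)$ if $a\le b$ and $\prod_{j=b}^{a-1}F(j)^{ -1}$ if $a>b$. $f$ is weakly factorial on $\mathcal R$ if there exist a finite $V\subset\mathbb{Z}^k$, univariate $a_{\mathbf v},b_{\mathbf v}\in K[z]$ for $\mathbf v\in V$, and $\mathbf z_0\in\mathcal R$ such that for all $\mathbf z\in\mathcal R$, $f(\mathbf z)=\prod_{\mathbf v\in V}\operatorname{GP}_{j=\mathbf z_0\cdot\mathbf v}^{\mathbf z\cdot\mathbf v}a_{\mathbf v}(j)/b_{\mathbf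 v}(j)$ and all $a_{\mathbf v}(j),b_{\mathbf v}(j)$ occurring in these products are nonzero. $f$ is factorial on $\mathcal R$ if there exist a finite $V\subset\mathbb{Z}^k$ and, for $\mathbf v\in V$, univariate $a_{\mathbf v},b_{\mathbf v}\in K[z]$ and integers $n_{\mathbf v}$ such that for all $\mathbf z\in\mathcal R$: $f(\mathbf z)=\prod_{\mathbf v\in V}\prod_{j=1}^{\mathbf v\cdot\mathbf z+n_{\mathbf v}}a_{\mathbf v}(j)/b_{\mathbf v}(j)$; each $\mathbf v\cdot\mathbf z+n_{\mathbf v}$ is a positive integer; and $a_{\mathbf v}(j),b_{\mathbf v}(j)\ne0$ for $1\le j\le\mathbf v\cdot\mathbf z+n_{\mathbf v}$. -}

module Defs where

open import Level using (Level; _⊔_) renaming (suc to lsuc)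
open import Algebra.Bundles using (CommutativeRing)
open import Data.Nat using (ℕ; zero; suc)
open import Data.Integer as ℤ using (ℤ; +_; -[1+_]; ∣_∣)
open import Data.Fin using (Fin)
open import Data.Fin.Properties using () renaming (_≟_ to _≟ᶠ_)
open import Data.Vec using (Vec; []; _∷_; zipWith; foldr; tabulate; map)
open import Data.List as List using (List)
open import Data.List.Relation.Unary.Any using (Any)
open import Data.List.Relation.Unary.All using (All)
open import Data.List.Relation.Unary.Unique.Propositional using (Unique)
open import Data.Product using (Σ; ∃; _×_; _,_; proj₁)
open import Relation.Nullary using (¬_; yes; no)
open import Relation.Binary.PropositionalEquality using (_≡_)

-- Fields: a commutative ring with 0 ≠ 1 and a (total) inverse function
-- that inverts every nonzero element (its value at 0 is irrelevant).

record Field (c ℓ : Level) : Set (lsuc (c ⊔ ℓ)) where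
  field
    commutativeRing : CommutativeRing c ℓ
  open CommutativeRing commutativeRing public
  field
    _⁻¹      : Carrier → Carrier
    inverse  : ∀ x → ¬ (x ≈ 0#) → x * (x ⁻¹) ≈ 1#
    0≉1      : ¬ (0# ≈ 1#)

Point : ℕ → Set
Point k = Vec ℤ k

_·_ : ∀ {k} → Point k → Point k → ℤ
v · z = foldr _ ℤ._+_ (+ 0) (zipWith ℤ._*_ v z)

e : ∀ {k} → Fin k → Point k
e i = tabulate (λ j → f j)
  where
  f : _ → ℤ
  f j with j ≟ᶠ i
  ... | yes _ = + 1
  ... | no  _ = + 0

_+ᵥ_ : ∀ {k} → Point k → Point k → Point k
_+ᵥ_ = zipWith ℤ._+_

-- Polyhedral regions: a finite list of half-spaces {z | v·z > n};
-- the empty list is the whole of ℤ^k.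

HalfSpace : ℕ → Set
HalfSpace k = Point k × ℤ

Region : ℕ → Set
Region k = List (HalfSpace k)

InHalfSpace : ∀ {k} → Point k → HalfSpace k → Set
InHalfSpace z (v , n) = n ℤ.< v · z

_∈R_ : ∀ {k} → Point k → Region k → Set
z ∈R R = All (InHalfSpace z) R

module _ {c ℓ : Level} (F : Field c ℓ) where
  open Field F

  fromℕ : ℕ → Carrier
  fromℕ zero    = 0#
  fromℕ (suc n) = 1# + fromℕ n

  fromℤ : ℤ → Carrier
  fromℤ (+ n)    = fromℕ n
  fromℤ -[1+ n ] = - fromℕ (suc n)

  -- multivariate polynomials K[z_1,…,z_k] in recursive dense form:
  -- K[z_1,…,z_{k+1}] = K[z_2,…,z_{k+1}][z_1] (coefficient lists, low degree first)
  Poly : ℕ → Set c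
  Poly zero    = Carrier
  Poly (suc k) = List (Poly k)

  evalP : ∀ {k} → Poly k → Vec Carrier k → Carrier
  evalP {zero}  c  []       = c
  evalP {suc k} cs (x ∷ xs) = List.foldr (λ a acc → evalP a xs + x * acc) 0# cs

  NonZeroPoly : ∀ {k} → Poly k → Set (c ⊔ ℓ)
  NonZeroPoly {zero}  x  = Level.Lift c (¬ (x ≈ 0#))
  NonZeroPoly {suc k} cs = Any (NonZeroPoly {k}) cs

  UPoly : Set c
  UPoly = List Carrier

  evalU : UPoly → ℤ → Carrier
  evalU p j = List.foldr (λ a acc → a + fromℤ j * acc) 0# p

  Hypergeometric : ∀ {k} → (Point k → Carrier) → Set (c ⊔ ℓ)
  Hypergeometric {k} f = (i : Fin k) → Σ (Poly k) λ A → Σ (Poly k) λ B →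
      NonZeroPoly {k} A × NonZeroPoly {k} B ×
      ((z : Point k) → evalP A (map fromℤ z) * f z ≈ evalP B (map fromℤ z) * f (z +ᵥ e i))

  prodFrom : ℤ → ℕ → (ℤ → Carrier) → Carrier
  prodFrom a zero    G = 1#
  prodFrom a (suc n) G = G a * prodFrom (a ℤ.+ + 1) n G

  GP : ℤ → ℤ → (ℤ → Carrier) → Carrier
  GP a b G with a ℤ.≤? b
  ... | yes _ = prodFrom a ∣ b ℤ.- a ∣ G
  ... | no  _ = prodFrom b ∣ a ℤ.- b ∣ (λ j → G j ⁻¹)

  ratio : UPoly → UPoly → ℤ → Carrier
  ratio a b j = evalU a j * (evalU b j) ⁻¹

  prodList : ∀ {a} {A : Set a} → (A → Carrier) → List A → Carrier
  prodList g = List.foldr (λ x acc → g x * acc) 1#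

  WFData : ℕ → Set c
  WFData k = Point k × UPoly × UPoly

  FData : ℕ → Set c
  FData k = Point k × UPoly × UPoly × ℤ

  WeaklyFactorial : ∀ {k} → (Point k → Carrier) → Region k → Set (c ⊔ ℓ)
  WeaklyFactorial {k} f R =
    Σ (List (WFData k)) λ V → Unique (List.map proj₁ V) ×
    Σ (Point k) λ z₀ → z₀ ∈R R ×
    ((z : Point k) → z ∈R R →
       (f z ≈ prodList (λ { (v , a , b) → GP (z₀ · v) (z · v) (ratio a b) }) V)
       × All (λ { (v , a , b) → (j : ℤ) →
                   ((z₀ · v) ℤ.⊓ (z · v)) ℤ.≤ j → j ℤ.< ((z₀ · v) ℤ.⊔ (z · v)) →
                   ¬ (evalU a j ≈ 0#) × ¬ (evalU b j ≈ 0#) }) V)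

  Factorial : ∀ {k} → (Point k → Carrier) → Region k → Set (c ⊔ ℓ)
  Factorial {k} f R =
    Σ (List (FData k)) λ V → Unique (List.map proj₁ V) ×
    ((z : Point k) → z ∈R R →
       (f z ≈ prodList (λ { (v , a , b , n) → prodFrom (+ 1) ∣ v · z ℤ.+ n ∣ (ratio a b) }) V)
       × All (λ { (v , a , b , n) → (+ 0 ℤ.< v · z ℤ.+ n) ×
                   ((j : ℤ) → + 1 ℤ.≤ j → j ℤ.≤ v · z ℤ.+ n →
                    ¬ (evalU a j ≈ 0#) × ¬ (evalU b j ≈ 0#)) }) V)

-- For each (v, a, b) in V the factor GP_{z₀·v}^{z·v} a(j)/b(j) is, according to the sign of
-- v·z - v·z₀, an ascending product, a reciprocal product, or empty.  An ascending product
-- becomes a factorial term for the vector v after shifting its index to start at 1; a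
-- reciprocal product becomes a factorial term for -v with the roles of a and b exchanged
-- after the reflection j ↦ z₀·v - j.  Splitting R by these three cases for every v gives at
-- most 3^|V| polyhedral pieces; on each piece, factorial terms with the same vector are merged
-- by multiplying their polynomials.
module Submission where

open import Defs
open import Level using (Level; _⊔_)
import Algebra.Properties.Ring as RingProperties
import Algebra.Solver.Ring.NaturalCoefficients.Default as NaturalCoefficients
open import Data.Empty using (⊥-elim)
open import Data.Integer as ℤ using (ℤ; +_; -[1+_]; ∣_∣; _⊖_; +<+; +≤+)
import Data.Integer.Properties as ℤP
import Data.Nat.Properties as ℕP
open import Data.Integer.Tactic.RingSolver using (solve-∀)
open import Data.List as List using (List; []; _∷_; _++_)
import Data.List.Properties as ListP
open import Data.List.Relation.Unary.All as All using (All; []; _∷_)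
import Data.List.Relation.Unary.All.Properties as AllP
open import Data.List.Relation.Unary.AllPairs using ([]; _∷_)
open import Data.List.Relation.Unary.Any using (Any; here; there)
import Data.List.Relation.Unary.Any.Properties as AnyP
open import Data.List.Relation.Unary.Unique.Propositional using (Unique)
open import Data.Nat as ℕ using (ℕ; zero; suc; z≤n; s≤s)
open import Data.Product using (Σ; _×_; _,_; proj₁; proj₂)
open import Data.Sum using (inj₁; inj₂)
open import Data.Vec as Vec using ([]; _∷_)
import Data.Vec.Properties as VecP
open import Function.Bundles using (_⇔_; mk⇔; Equivalence)
import Function.Properties.Equivalence as ⇔
open import Relation.Binary.Definitions using (tri<; tri≈; tri>)
open import Relation.Binary.PropositionalEquality as ≡ using (_≡_)
open import Relation.Nullary using (¬_; yes; no; Dec)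


<⇒0<-diff : ∀ {x y} → x ℤ.< y → + 0 ℤ.< y ℤ.- x
<⇒0<-diff {x} {y} x<y =
  ≡.subst (ℤ._< y ℤ.- x) (ℤP.+-inverseʳ x) (ℤP.+-monoˡ-< (ℤ.- x) x<y)

<⇒≡+∣-∣ : ∀ {x y} → x ℤ.< y → y ≡ x ℤ.+ + ∣ y ℤ.- x ∣
<⇒≡+∣-∣ {x} {y} x<y
  rewrite ℤP.0≤i⇒+∣i∣≡i (ℤP.<⇒≤ (<⇒0<-diff x<y)) = split x y
  where
  split : ∀ x y → y ≡ x ℤ.+ (y ℤ.- x)
  split = solve-∀

ascending-between : ∀ {p q i} → p ℤ.< q → i ℕ.< ∣ q ℤ.- p ∣ →
                    p ℤ.⊓ q ℤ.≤ p ℤ.+ + i × p ℤ.+ + i ℤ.< p ℤ.⊔ q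
ascending-between {p} {q} {i} p<q i<m
  rewrite ℤP.i≤j⇒i⊓j≡i (ℤP.<⇒≤ p<q) | ℤP.i≤j⇒i⊔j≡j (ℤP.<⇒≤ p<q) =
  ℤP.i≤i+j p (+ i) ,
  ≡.subst (p ℤ.+ + i ℤ.<_) (≡.sym (<⇒≡+∣-∣ p<q)) (ℤP.+-monoʳ-< p (+<+ i<m))

descending-between : ∀ {p q i} → q ℤ.< p → i ℕ.< ∣ p ℤ.- q ∣ →
                     p ℤ.⊓ q ℤ.≤ p ℤ.- + suc i × p ℤ.- + suc i ℤ.< p ℤ.⊔ q
descending-between {p} {q} {i} q<p i<m
  rewrite ℤP.i≥j⇒i⊓j≡j (ℤP.<⇒≤ q<p) | ℤP.i≥j⇒i⊔j≡i (ℤP.<⇒≤ q<p) =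
  ≡.subst (ℤ._≤ p ℤ.- + suc i) (cancel q (+ suc i)) q+s-s≤p-s ,
  ≡.subst (p ℤ.- + suc i ℤ.<_) (ℤP.+-identityʳ p) (ℤP.+-monoʳ-< p ℤ.-<+)
  where
  cancel : ∀ q s → q ℤ.+ s ℤ.- s ≡ q
  cancel = solve-∀
  q+s-s≤p-s : q ℤ.+ + suc i ℤ.- + suc i ℤ.≤ p ℤ.- + suc i
  q+s-s≤p-s = ℤP.+-monoˡ-≤ (ℤ.- + suc i)
    (≡.subst (q ℤ.+ + suc i ℤ.≤_) (≡.sym (<⇒≡+∣-∣ q<p)) (ℤP.+-monoʳ-≤ q (+≤+ i<m)))

pred<⇒≤ : ∀ {n x} → ℤ.pred n ℤ.< x → n ℤ.≤ x
pred<⇒≤ {n} lt = ≡.subst (ℤ._≤ _) (ℤP.suc-pred n) (ℤP.i<j⇒suc[i]≤j lt)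

pred< : ∀ n → ℤ.pred n ℤ.< n
pred< n = ℤP.i≤pred[j]⇒i<j ℤP.≤-refl

Window : ∀ {p} → ℤ → ℕ → (ℤ → Set p) → Set p
Window a m P = ∀ i → i ℕ.< m → P (a ℤ.+ + i)

window⇒range : ∀ {p} {L} {P : ℤ → Set p} → + 0 ℤ.< L → Window (+ 1) ∣ L ∣ P →
               (j : ℤ) → + 1 ℤ.≤ j → j ℤ.≤ L → P j
window⇒range (+<+ _) w .(+ suc _) (+≤+ (s≤s z≤n)) (+≤+ j≤L) = w _ j≤L

Window-uncons : ∀ {p} {P : ℤ → Set p} a m → Window a (suc m) P → P a × Window (a ℤ.+ + 1) m P
Window-uncons {P = P} a m w =
  ≡.subst P (ℤP.+-identityʳ a) (w 0 (s≤s z≤n)) ,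
  λ i i<m → ≡.subst P (≡.sym (ℤP.+-assoc a (+ 1) (+ i))) (w (suc i) (s≤s i<m))


module FieldProperties {c ℓ : Level} (F : Field c ℓ) where
  open Field F
  open NaturalCoefficients commutativeSemiring
  open import Relation.Binary.Reasoning.Setoid setoid

  infix 4 _≉0
  _≉0 : Carrier → Set ℓ
  x ≉0 = ¬ (x ≈ 0#)

  infixl 7 _/_
  _/_ : Carrier → Carrier → Carrier
  x / y = x * y ⁻¹

  ≉0-resp-≈ : ∀ {x y} → x ≈ y → x ≉0 → y ≉0
  ≉0-resp-≈ x≈y x≉0 y≈0 = x≉0 (trans x≈y y≈0)

  ⁻¹-unique : ∀ {x u} → x ≉0 → x * u ≈ 1# → u ≈ x ⁻¹
  ⁻¹-unique {x} {u} x≉0 xu≈1 = begin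
    u                ≈⟨ sym (*-identityʳ u) ⟩
    u * 1#           ≈⟨ *-congˡ (sym (inverse x x≉0)) ⟩
    u * (x * x ⁻¹)   ≈⟨ solve 3 (λ u x y → u :* (x :* y) := (x :* u) :* y) refl u x (x ⁻¹) ⟩
    (x * u) * x ⁻¹   ≈⟨ *-congʳ xu≈1 ⟩
    1# * x ⁻¹        ≈⟨ *-identityˡ _ ⟩
    x ⁻¹             ∎

  ⁻¹-≉0 : ∀ {x} → x ≉0 → x ⁻¹ ≉0
  ⁻¹-≉0 {x} x≉0 x⁻¹≈0 = 0≉1 (begin
    0#         ≈⟨ sym (zeroʳ x) ⟩
    x * 0#     ≈⟨ *-congˡ (sym x⁻¹≈0) ⟩
    x * x ⁻¹   ≈⟨ inverse x x≉0 ⟩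
    1#         ∎)

  ⁻¹-cong : ∀ {x y} → x ≉0 → x ≈ y → x ⁻¹ ≈ y ⁻¹
  ⁻¹-cong x≉0 x≈y =
    ⁻¹-unique (≉0-resp-≈ x≈y x≉0) (trans (*-congʳ (sym x≈y)) (inverse _ x≉0))

  ⁻¹-involutive : ∀ {x} → x ≉0 → x ⁻¹ ⁻¹ ≈ x
  ⁻¹-involutive {x} x≉0 = sym (⁻¹-unique (⁻¹-≉0 x≉0) (trans (*-comm _ _) (inverse x x≉0)))

  *-inverses : ∀ {x y} → x ≉0 → y ≉0 → (x * y) * (x ⁻¹ * y ⁻¹) ≈ 1#
  *-inverses {x} {y} x≉0 y≉0 = begin
    (x * y) * (x ⁻¹ * y ⁻¹)
      ≈⟨ solve 4 (λ a b c d → (a :* b) :* (c :* d) := (a :* c) :* (b :* d)) refl x y (x ⁻¹) (y ⁻¹) ⟩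
    (x * x ⁻¹) * (y * y ⁻¹)  ≈⟨ *-cong (inverse x x≉0) (inverse y y≉0) ⟩
    1# * 1#                  ≈⟨ *-identityˡ 1# ⟩
    1#                       ∎

  *-≉0 : ∀ {x y} → x ≉0 → y ≉0 → x * y ≉0
  *-≉0 {x} {y} x≉0 y≉0 xy≈0 = 0≉1 (begin
    0#                        ≈⟨ sym (zeroˡ _) ⟩
    0# * (x ⁻¹ * y ⁻¹)        ≈⟨ *-congʳ (sym xy≈0) ⟩
    (x * y) * (x ⁻¹ * y ⁻¹)   ≈⟨ *-inverses x≉0 y≉0 ⟩
    1#                        ∎)

  ⁻¹-distrib-* : ∀ {x y} → x ≉0 → y ≉0 → (x * y) ⁻¹ ≈ x ⁻¹ * y ⁻¹
  ⁻¹-distrib-* x≉0 y≉0 = sym (⁻¹-unique (*-≉0 x≉0 y≉0) (*-inverses x≉0 y≉0))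

  /-cong : ∀ {x x′ y y′} → y ≉0 → x ≈ x′ → y ≈ y′ → x / y ≈ x′ / y′
  /-cong y≉0 x≈x′ y≈y′ = *-cong x≈x′ (⁻¹-cong y≉0 y≈y′)

  /-⁻¹ : ∀ {x y} → x ≉0 → y ≉0 → (x / y) ⁻¹ ≈ y / x
  /-⁻¹ {x} {y} x≉0 y≉0 = begin
    (x * y ⁻¹) ⁻¹       ≈⟨ ⁻¹-distrib-* x≉0 (⁻¹-≉0 y≉0) ⟩
    x ⁻¹ * y ⁻¹ ⁻¹      ≈⟨ *-congˡ (⁻¹-involutive y≉0) ⟩
    x ⁻¹ * y            ≈⟨ *-comm _ _ ⟩
    y * x ⁻¹            ∎

  /-* : ∀ {A a B b} → B ≉0 → b ≉0 → (A * a) / (B * b) ≈ (A / B) * (a / b)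
  /-* {A} {a} {B} {b} B≉0 b≉0 = begin
    (A * a) * (B * b) ⁻¹     ≈⟨ *-congˡ (⁻¹-distrib-* B≉0 b≉0) ⟩
    (A * a) * (B ⁻¹ * b ⁻¹)
      ≈⟨ solve 4 (λ A a B b → (A :* a) :* (B :* b) := (A :* B) :* (a :* b)) refl A a (B ⁻¹) (b ⁻¹) ⟩
    (A * B ⁻¹) * (a * b ⁻¹)  ∎


module IntegerEmbedding {c ℓ : Level} (F : Field c ℓ) where
  open Field F
  open RingProperties ring using (-‿+-comm; -0#≈0#; -‿involutive)
  open NaturalCoefficients commutativeSemiring
  open import Relation.Binary.Reasoning.Setoid setoid

  fromℕ-+ : ∀ m n → fromℕ F (m ℕ.+ n) ≈ fromℕ F m + fromℕ F n
  fromℕ-+ zero    n = sym (+-identityˡ _)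
  fromℕ-+ (suc m) n = trans (+-congˡ (fromℕ-+ m n)) (sym (+-assoc _ _ _))

  x≈x-0 : ∀ x → x ≈ x - 0#
  x≈x-0 x = sym (trans (+-congˡ -0#≈0#) (+-identityʳ x))

  +-cancel-diff : ∀ x a b → (x + a) - (x + b) ≈ a - b
  +-cancel-diff x a b = begin
    (x + a) - (x + b)          ≈⟨ +-congˡ (sym (-‿+-comm x b)) ⟩
    (x + a) + (- x + - b)
      ≈⟨ solve 4 (λ x a nx nb → (x :+ a) :+ (nx :+ nb) := (x :+ nx) :+ (a :+ nb)) refl x a (- x) (- b) ⟩
    (x - x) + (a - b)          ≈⟨ +-congʳ (-‿inverseʳ x) ⟩
    0# + (a - b)               ≈⟨ +-identityˡ _ ⟩
    a - b                      ∎

  fromℤ-⊖ : ∀ m n → fromℤ F (m ⊖ n) ≈ fromℕ F m - fromℕ F n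
  fromℤ-⊖ zero    zero    = x≈x-0 0#
  fromℤ-⊖ (suc m) zero    = x≈x-0 _
  fromℤ-⊖ zero    (suc n) = sym (+-identityˡ _)
  fromℤ-⊖ (suc m) (suc n) rewrite ℤP.[1+m]⊖[1+n]≡m⊖n m n =
    trans (fromℤ-⊖ m n) (sym (+-cancel-diff 1# (fromℕ F m) (fromℕ F n)))

  fromℤ-+ : ∀ i j → fromℤ F (i ℤ.+ j) ≈ fromℤ F i + fromℤ F j
  fromℤ-+ (+ m)    (+ n)    = fromℕ-+ m n
  fromℤ-+ (+ m)    -[1+ n ] = fromℤ-⊖ m (suc n)
  fromℤ-+ -[1+ m ] (+ n)    = trans (fromℤ-⊖ n (suc m)) (+-comm _ _)
  fromℤ-+ -[1+ m ] -[1+ n ] = begin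
    - (1# + (1# + fromℕ F (m ℕ.+ n)))   ≈⟨ -‿cong (+-congˡ (reflexive (≡.cong (fromℕ F) (≡.sym (ℕP.+-suc m n))))) ⟩
    - fromℕ F (suc m ℕ.+ suc n)         ≈⟨ -‿cong (fromℕ-+ (suc m) (suc n)) ⟩
    - (fromℕ F (suc m) + fromℕ F (suc n)) ≈⟨ sym (-‿+-comm _ _) ⟩
    - fromℕ F (suc m) + - fromℕ F (suc n) ∎

  fromℤ-neg : ∀ i → fromℤ F (ℤ.- i) ≈ - fromℤ F i
  fromℤ-neg (+ zero)  = sym -0#≈0#
  fromℤ-neg (+ suc n) = refl
  fromℤ-neg -[1+ n ]  = sym (-‿involutive _)


module PolynomialArithmetic {c ℓ : Level} (F : Field c ℓ) where
  open Field F
  open RingProperties ring using (-1*x≈-x)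
  open NaturalCoefficients commutativeSemiring
  open IntegerEmbedding F
  open import Relation.Binary.Reasoning.Setoid setoid

  -- evalU F p j is definitionally eval p (fromℤ F j).
  eval : UPoly F → Carrier → Carrier
  eval p x = List.foldr (λ a acc → a + x * acc) 0# p

  eval-cong : ∀ p {x y} → x ≈ y → eval p x ≈ eval p y
  eval-cong []      x≈y = refl
  eval-cong (a ∷ p) x≈y = +-congˡ (*-cong x≈y (eval-cong p x≈y))

  eval-linear : ∀ c s x → eval (c ∷ s ∷ []) x ≈ c + s * x
  eval-linear c s x = +-congˡ (begin
    x * (s + x * 0#)   ≈⟨ *-congˡ (trans (+-congˡ (zeroʳ x)) (+-identityʳ s)) ⟩
    x * s              ≈⟨ *-comm x s ⟩
    s * x              ∎)

  infixl 6 _+ₚ_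
  infixl 7 _*ₚ_

  _+ₚ_ : UPoly F → UPoly F → UPoly F
  []      +ₚ Q       = Q
  (a ∷ P) +ₚ []      = a ∷ P
  (a ∷ P) +ₚ (b ∷ Q) = (a + b) ∷ (P +ₚ Q)

  scaleₚ : Carrier → UPoly F → UPoly F
  scaleₚ a = List.map (a *_)

  _*ₚ_ : UPoly F → UPoly F → UPoly F
  []      *ₚ Q = []
  (a ∷ P) *ₚ Q = scaleₚ a Q +ₚ (0# ∷ P *ₚ Q)

  _∘ₚ_ : UPoly F → UPoly F → UPoly F
  P ∘ₚ Q = List.foldr (λ a acc → (a ∷ []) +ₚ Q *ₚ acc) [] P

  eval-+ₚ : ∀ P Q x → eval (P +ₚ Q) x ≈ eval P x + eval Q x
  eval-+ₚ []      Q       x = sym (+-identityˡ _)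
  eval-+ₚ (a ∷ P) []      x = sym (+-identityʳ _)
  eval-+ₚ (a ∷ P) (b ∷ Q) x = begin
    (a + b) + x * eval (P +ₚ Q) x          ≈⟨ +-congˡ (*-congˡ (eval-+ₚ P Q x)) ⟩
    (a + b) + x * (eval P x + eval Q x)
      ≈⟨ solve 5 (λ a b x P Q → (a :+ b) :+ x :* (P :+ Q) := (a :+ x :* P) :+ (b :+ x :* Q))
               refl a b x (eval P x) (eval Q x) ⟩
    (a + x * eval P x) + (b + x * eval Q x) ∎

  eval-scaleₚ : ∀ a P x → eval (scaleₚ a P) x ≈ a * eval P x
  eval-scaleₚ a []      x = sym (zeroʳ a)
  eval-scaleₚ a (b ∷ P) x = begin
    a * b + x * eval (scaleₚ a P) x   ≈⟨ +-congˡ (*-congˡ (eval-scaleₚ a P x)) ⟩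
    a * b + x * (a * eval P x)
      ≈⟨ solve 4 (λ a b x P → a :* b :+ x :* (a :* P) := a :* (b :+ x :* P)) refl a b x (eval P x) ⟩
    a * (b + x * eval P x)            ∎

  eval-*ₚ : ∀ P Q x → eval (P *ₚ Q) x ≈ eval P x * eval Q x
  eval-*ₚ []      Q x = sym (zeroˡ _)
  eval-*ₚ (a ∷ P) Q x = begin
    eval (scaleₚ a Q +ₚ (0# ∷ P *ₚ Q)) x                ≈⟨ eval-+ₚ (scaleₚ a Q) _ x ⟩
    eval (scaleₚ a Q) x + (0# + x * eval (P *ₚ Q) x)
      ≈⟨ +-cong (eval-scaleₚ a Q x) (trans (+-identityˡ _) (*-congˡ (eval-*ₚ P Q x))) ⟩
    a * eval Q x + x * (eval P x * eval Q x)
      ≈⟨ solve 4 (λ a x P Q → a :* Q :+ x :* (P :* Q) := (a :+ x :* P) :* Q) refl a x (eval P x) (eval Q x) ⟩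
    (a + x * eval P x) * eval Q x                       ∎

  eval-∘ₚ : ∀ P Q x → eval (P ∘ₚ Q) x ≈ eval P (eval Q x)
  eval-∘ₚ []      Q x = refl
  eval-∘ₚ (a ∷ P) Q x = begin
    eval ((a ∷ []) +ₚ Q *ₚ (P ∘ₚ Q)) x                ≈⟨ eval-+ₚ (a ∷ []) (Q *ₚ (P ∘ₚ Q)) x ⟩
    (a + x * 0#) + eval (Q *ₚ (P ∘ₚ Q)) x              ≈⟨ +-cong (trans (+-congˡ (zeroʳ x)) (+-identityʳ a)) (eval-*ₚ Q _ x) ⟩
    a + eval Q x * eval (P ∘ₚ Q) x                     ≈⟨ +-congˡ (*-congˡ (eval-∘ₚ P Q x)) ⟩
    a + eval Q x * eval P (eval Q x)                   ∎

  shiftU : UPoly F → ℤ → UPoly F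
  shiftU p d = p ∘ₚ (fromℤ F d ∷ 1# ∷ [])

  reflectU : UPoly F → ℤ → UPoly F
  reflectU p a = p ∘ₚ (fromℤ F a ∷ - 1# ∷ [])

  evalU-*ₚ : ∀ P Q j → evalU F (P *ₚ Q) j ≈ evalU F P j * evalU F Q j
  evalU-*ₚ P Q j = eval-*ₚ P Q (fromℤ F j)

  evalU-shift : ∀ p d j → evalU F (shiftU p d) j ≈ evalU F p (j ℤ.+ d)
  evalU-shift p d j = trans (eval-∘ₚ p (fromℤ F d ∷ 1# ∷ []) (fromℤ F j)) (eval-cong p (begin
    eval (fromℤ F d ∷ 1# ∷ []) (fromℤ F j)   ≈⟨ eval-linear _ 1# _ ⟩
    fromℤ F d + 1# * fromℤ F j               ≈⟨ +-congˡ (*-identityˡ _) ⟩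
    fromℤ F d + fromℤ F j                    ≈⟨ +-comm _ _ ⟩
    fromℤ F j + fromℤ F d                    ≈⟨ sym (fromℤ-+ j d) ⟩
    fromℤ F (j ℤ.+ d)                        ∎))

  evalU-reflect : ∀ p a j → evalU F (reflectU p a) j ≈ evalU F p (a ℤ.- j)
  evalU-reflect p a j = trans (eval-∘ₚ p (fromℤ F a ∷ - 1# ∷ []) (fromℤ F j)) (eval-cong p (begin
    eval (fromℤ F a ∷ - 1# ∷ []) (fromℤ F j)   ≈⟨ eval-linear _ (- 1#) _ ⟩
    fromℤ F a + - 1# * fromℤ F j               ≈⟨ +-congˡ (-1*x≈-x _) ⟩
    fromℤ F a + - fromℤ F j                    ≈⟨ +-congˡ (sym (fromℤ-neg j)) ⟩
    fromℤ F a + fromℤ F (ℤ.- j)                ≈⟨ sym (fromℤ-+ a (ℤ.- j)) ⟩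
    fromℤ F (a ℤ.- j)                          ∎))


module Products {c ℓ : Level} (F : Field c ℓ) where
  open Field F
  open import Relation.Binary.Reasoning.Setoid setoid

  prodFrom-cong : ∀ m a {G H : ℤ → Carrier} → Window a m (λ j → G j ≈ H j) →
                  prodFrom F a m G ≈ prodFrom F a m H
  prodFrom-cong zero    a eq = refl
  prodFrom-cong (suc m) a {G} {H} eq with Window-uncons {P = λ j → G j ≈ H j} a m eq
  ... | eq₀ , eqs = *-cong eq₀ (prodFrom-cong m (a ℤ.+ + 1) eqs)

  prodFrom-shift : ∀ m a d (G : ℤ → Carrier) →
                   prodFrom F (a ℤ.+ d) m G ≡ prodFrom F a m (λ j → G (j ℤ.+ d))
  prodFrom-shift zero    a d G = ≡.refl
  prodFrom-shift (suc m) a d G = ≡.cong (G (a ℤ.+ d) *_)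
    (≡.trans (≡.cong (λ s → prodFrom F s m G) (swap a d)) (prodFrom-shift m (a ℤ.+ + 1) d G))
    where
    swap : ∀ a d → a ℤ.+ d ℤ.+ + 1 ≡ a ℤ.+ + 1 ℤ.+ d
    swap = solve-∀

  prodFrom-* : ∀ m a (G H : ℤ → Carrier) →
               prodFrom F a m (λ j → G j * H j) ≈ prodFrom F a m G * prodFrom F a m H
  prodFrom-* zero    a G H = sym (*-identityˡ 1#)
  prodFrom-* (suc m) a G H = begin
    (G a * H a) * prodFrom F (a ℤ.+ + 1) m (λ j → G j * H j)
      ≈⟨ *-congˡ (prodFrom-* m (a ℤ.+ + 1) G H) ⟩
    (G a * H a) * (prodFrom F (a ℤ.+ + 1) m G * prodFrom F (a ℤ.+ + 1) m H)
      ≈⟨ solve 4 (λ a b c d → (a :* b) :* (c :* d) := (a :* c) :* (b :* d)) refl (G a) (H a) _ _ ⟩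
    (G a * prodFrom F (a ℤ.+ + 1) m G) * (H a * prodFrom F (a ℤ.+ + 1) m H) ∎
    where open NaturalCoefficients commutativeSemiring

  prodFrom-snoc : ∀ m a (G : ℤ → Carrier) → prodFrom F a (suc m) G ≈ prodFrom F a m G * G (a ℤ.+ + m)
  prodFrom-snoc zero    a G = trans (*-comm _ _) (*-congˡ (reflexive (≡.cong G (≡.sym (ℤP.+-identityʳ a)))))
  prodFrom-snoc (suc m) a G = begin
    G a * prodFrom F (a ℤ.+ + 1) (suc m) G                        ≈⟨ *-congˡ (prodFrom-snoc m (a ℤ.+ + 1) G) ⟩
    G a * (prodFrom F (a ℤ.+ + 1) m G * G (a ℤ.+ + 1 ℤ.+ + m))    ≈⟨ sym (*-assoc _ _ _) ⟩
    (G a * prodFrom F (a ℤ.+ + 1) m G) * G (a ℤ.+ + 1 ℤ.+ + m)    ≈⟨ *-congˡ (reflexive (≡.cong G (ℤP.+-assoc a (+ 1) (+ m)))) ⟩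
    (G a * prodFrom F (a ℤ.+ + 1) m G) * G (a ℤ.+ + suc m)        ∎

  prodFrom-reverse : ∀ m a b (H : ℤ → Carrier) → b ≡ a ℤ.+ + m →
                     prodFrom F a m H ≈ prodFrom F (+ 1) m (λ j → H (b ℤ.- j))
  prodFrom-reverse zero    a b H b≡a+m = refl
  prodFrom-reverse (suc m) a b H b≡a+m = begin
    H a * prodFrom F (a ℤ.+ + 1) m H      ≈⟨ *-congˡ (prodFrom-reverse m (a ℤ.+ + 1) b H b≡a+1+m) ⟩
    H a * prodFrom F (+ 1) m H′           ≈⟨ *-comm _ _ ⟩
    prodFrom F (+ 1) m H′ * H a           ≈⟨ *-congˡ (reflexive (≡.cong H a≡b-[1+m])) ⟩
    prodFrom F (+ 1) m H′ * H′ (+ suc m)  ≈⟨ sym (prodFrom-snoc m (+ 1) H′) ⟩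
    prodFrom F (+ 1) (suc m) H′           ∎
    where
    H′ : ℤ → Carrier
    H′ j = H (b ℤ.- j)
    b≡a+1+m : b ≡ a ℤ.+ + 1 ℤ.+ + m
    b≡a+1+m = ≡.trans b≡a+m (≡.sym (ℤP.+-assoc a (+ 1) (+ m)))
    cancel : ∀ a m → a ≡ a ℤ.+ m ℤ.- m
    cancel = solve-∀
    a≡b-[1+m] : a ≡ b ℤ.- + suc m
    a≡b-[1+m] rewrite b≡a+m = cancel a (+ suc m)

  GP-ascending : ∀ {p q} (G : ℤ → Carrier) → p ℤ.≤ q → GP F p q G ≡ prodFrom F p ∣ q ℤ.- p ∣ G
  GP-ascending {p} {q} G p≤q with p ℤ.≤? q
  ... | yes _   = ≡.refl
  ... | no  p≰q = ⊥-elim (p≰q p≤q)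

  GP-descending : ∀ {p q} (G : ℤ → Carrier) → q ℤ.< p →
                  GP F p q G ≡ prodFrom F q ∣ p ℤ.- q ∣ (λ j → G j ⁻¹)
  GP-descending {p} {q} G q<p with p ℤ.≤? q
  ... | yes p≤q = ⊥-elim (ℤP.<-irrefl ≡.refl (ℤP.<-≤-trans q<p p≤q))
  ... | no  _   = ≡.refl

  GP-empty : ∀ p (G : ℤ → Carrier) → GP F p p G ≈ 1#
  GP-empty p G rewrite GP-ascending {p} G ℤP.≤-refl | ℤP.+-inverseʳ p = refl


module Runs {c ℓ : Level} (F : Field c ℓ) where
  open Field F
  open FieldProperties F
  open PolynomialArithmetic F
  open Products F
  open import Relation.Binary.Reasoning.Setoid setoid

  record NonVanishing (a b : UPoly F) (j : ℤ) : Set ℓ where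
    constructor nonVanishing
    field
      numerator   : evalU F a j ≉0
      denominator : evalU F b j ≉0

  NonVanishingBetween : ℤ → ℤ → UPoly F → UPoly F → Set ℓ
  NonVanishingBetween p q a b = ∀ j → p ℤ.⊓ q ℤ.≤ j → j ℤ.< p ℤ.⊔ q → evalU F a j ≉0 × evalU F b j ≉0

  nonVanishing-between : ∀ {p q a b j} → NonVanishingBetween p q a b →
                         p ℤ.⊓ q ℤ.≤ j → j ℤ.< p ℤ.⊔ q → NonVanishing a b j
  nonVanishing-between nv lo hi = let a≉0 , b≉0 = nv _ lo hi in nonVanishing a≉0 b≉0

  run : ℤ → UPoly F → UPoly F → Carrier
  run L A B = prodFrom F (+ 1) ∣ L ∣ (ratio F A B)

  ValidRun : ℤ → UPoly F → UPoly F → Set ℓ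
  ValidRun L A B = + 0 ℤ.< L × Window (+ 1) ∣ L ∣ (NonVanishing A B)

  NonVanishing-shift : ∀ {a b d j} → NonVanishing a b (j ℤ.+ d) → NonVanishing (shiftU a d) (shiftU b d) j
  NonVanishing-shift {a} {b} {d} {j} (nonVanishing a≉0 b≉0) = nonVanishing
    (≉0-resp-≈ (sym (evalU-shift a d j)) a≉0)
    (≉0-resp-≈ (sym (evalU-shift b d j)) b≉0)

  NonVanishing-reflect : ∀ {a b p j} → NonVanishing a b (p ℤ.- j) → NonVanishing (reflectU b p) (reflectU a p) j
  NonVanishing-reflect {a} {b} {p} {j} (nonVanishing a≉0 b≉0) = nonVanishing
    (≉0-resp-≈ (sym (evalU-reflect b p j)) b≉0)
    (≉0-resp-≈ (sym (evalU-reflect a p j)) a≉0)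

  NonVanishing-*ₚ : ∀ {A B A′ B′ j} → NonVanishing A B j → NonVanishing A′ B′ j →
                    NonVanishing (A *ₚ A′) (B *ₚ B′) j
  NonVanishing-*ₚ {A} {B} {A′} {B′} {j} (nonVanishing A≉0 B≉0) (nonVanishing A′≉0 B′≉0) = nonVanishing
    (≉0-resp-≈ (sym (evalU-*ₚ A A′ j)) (*-≉0 A≉0 A′≉0))
    (≉0-resp-≈ (sym (evalU-*ₚ B B′ j)) (*-≉0 B≉0 B′≉0))

  ratio-shift : ∀ a b d j → evalU F b (j ℤ.+ d) ≉0 →
                ratio F a b (j ℤ.+ d) ≈ ratio F (shiftU a d) (shiftU b d) j
  ratio-shift a b d j b≉0 = /-cong b≉0 (sym (evalU-shift a d j)) (sym (evalU-shift b d j))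

  ratio-reflect : ∀ {a b p j} → NonVanishing a b (p ℤ.- j) →
                  ratio F a b (p ℤ.- j) ⁻¹ ≈ ratio F (reflectU b p) (reflectU a p) j
  ratio-reflect {a} {b} {p} {j} (nonVanishing a≉0 b≉0) =
    trans (/-⁻¹ a≉0 b≉0) (/-cong a≉0 (sym (evalU-reflect b p j)) (sym (evalU-reflect a p j)))

  ratio-*ₚ : ∀ {A B A′ B′ j} → NonVanishing A B j → NonVanishing A′ B′ j →
             ratio F (A *ₚ A′) (B *ₚ B′) j ≈ ratio F A B j * ratio F A′ B′ j
  ratio-*ₚ {A} {B} {A′} {B′} {j} (nonVanishing _ B≉0) (nonVanishing _ B′≉0) =
    trans (/-cong (≉0-resp-≈ (sym (evalU-*ₚ B B′ j)) (*-≉0 B≉0 B′≉0)) (evalU-*ₚ A A′ j) (evalU-*ₚ B B′ j))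
          (/-* B≉0 B′≉0)

  GP-ratio-ascending : ∀ {p q} a b → p ℤ.< q → NonVanishingBetween p q a b →
    let a′ = shiftU a (p ℤ.- + 1); b′ = shiftU b (p ℤ.- + 1) in
    GP F p q (ratio F a b) ≈ run (q ℤ.- p) a′ b′ × ValidRun (q ℤ.- p) a′ b′
  GP-ratio-ascending {p} {q} a b p<q nv =
    equation , <⇒0<-diff p<q , λ i i<m → NonVanishing-shift {d = d} (shifted i i<m)
    where
    d = p ℤ.- + 1
    m = ∣ q ℤ.- p ∣
    index : ∀ p i → + 1 ℤ.+ i ℤ.+ (p ℤ.- + 1) ≡ p ℤ.+ i
    index = solve-∀
    from-one : ∀ p → p ≡ + 1 ℤ.+ (p ℤ.- + 1)
    from-one = solve-∀
    shifted : Window (+ 1) m (λ j → NonVanishing a b (j ℤ.+ d))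
    shifted i i<m with ascending-between p<q i<m
    ... | lo , hi = ≡.subst (NonVanishing a b) (≡.sym (index p (+ i))) (nonVanishing-between nv lo hi)
    equation : GP F p q (ratio F a b) ≈ run (q ℤ.- p) (shiftU a d) (shiftU b d)
    equation = begin
      GP F p q (ratio F a b)                           ≡⟨ GP-ascending _ (ℤP.<⇒≤ p<q) ⟩
      prodFrom F p m (ratio F a b)                     ≡⟨ ≡.cong (λ s → prodFrom F s m (ratio F a b)) (from-one p) ⟩
      prodFrom F (+ 1 ℤ.+ d) m (ratio F a b)           ≡⟨ prodFrom-shift m (+ 1) d _ ⟩
      prodFrom F (+ 1) m (λ j → ratio F a b (j ℤ.+ d))
        ≈⟨ prodFrom-cong m (+ 1) (λ i i<m → ratio-shift a b d (+ suc i) (NonVanishing.denominator (shifted i i<m))) ⟩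
      run (q ℤ.- p) (shiftU a d) (shiftU b d)          ∎

  GP-ratio-descending : ∀ {p q} a b → q ℤ.< p → NonVanishingBetween p q a b →
    GP F p q (ratio F a b) ≈ run (p ℤ.- q) (reflectU b p) (reflectU a p)
    × ValidRun (p ℤ.- q) (reflectU b p) (reflectU a p)
  GP-ratio-descending {p} {q} a b q<p nv =
    equation , <⇒0<-diff q<p , λ i i<m → NonVanishing-reflect {p = p} (reflected i i<m)
    where
    m = ∣ p ℤ.- q ∣
    reflected : Window (+ 1) m (λ j → NonVanishing a b (p ℤ.- j))
    reflected i i<m with descending-between q<p i<m
    ... | lo , hi = nonVanishing-between nv lo hi
    equation : GP F p q (ratio F a b) ≈ run (p ℤ.- q) (reflectU b p) (reflectU a p)
    equation = begin
      GP F p q (ratio F a b)                              ≡⟨ GP-descending _ q<p ⟩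
      prodFrom F q m (λ j → ratio F a b j ⁻¹)             ≈⟨ prodFrom-reverse m q p _ (<⇒≡+∣-∣ q<p) ⟩
      prodFrom F (+ 1) m (λ j → ratio F a b (p ℤ.- j) ⁻¹)
        ≈⟨ prodFrom-cong m (+ 1) (λ i i<m → ratio-reflect {p = p} (reflected i i<m)) ⟩
      run (p ℤ.- q) (reflectU b p) (reflectU a p)         ∎

  run-*ₚ : ∀ L {A B A′ B′} → Window (+ 1) ∣ L ∣ (NonVanishing A B) → Window (+ 1) ∣ L ∣ (NonVanishing A′ B′) →
           run L (A *ₚ A′) (B *ₚ B′) ≈ run L A B * run L A′ B′
  run-*ₚ L {A} {B} {A′} {B′} nz nz′ =
    trans (prodFrom-cong ∣ L ∣ (+ 1) (λ i i<m → ratio-*ₚ (nz i i<m) (nz′ i i<m)))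
          (prodFrom-* ∣ L ∣ (+ 1) (ratio F A B) (ratio F A′ B′))

  ValidRun-*ₚ : ∀ {L A B A′ B′} → ValidRun L A B → ValidRun L A′ B′ → ValidRun L (A *ₚ A′) (B *ₚ B′)
  ValidRun-*ₚ (0<L , nz) (_ , nz′) = 0<L , λ i i<m → NonVanishing-*ₚ (nz i i<m) (nz′ i i<m)


-ᵥ_ : ∀ {k} → Point k → Point k
-ᵥ_ = Vec.map (λ x → ℤ.- x)

·-comm : ∀ {k} (v z : Point k) → v · z ≡ z · v
·-comm []      []      = ≡.refl
·-comm (a ∷ v) (b ∷ z) = ≡.cong₂ ℤ._+_ (ℤP.*-comm a b) (·-comm v z)

·-negˡ : ∀ {k} (v z : Point k) → (-ᵥ v) · z ≡ ℤ.- (v · z)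
·-negˡ []      []      = ≡.refl
·-negˡ (a ∷ v) (b ∷ z) =
  ≡.trans (≡.cong₂ ℤ._+_ (≡.sym (ℤP.neg-distribˡ-* a b)) (·-negˡ v z))
          (≡.sym (ℤP.neg-distrib-+ (a ℤ.* b) (v · z)))

module _ {k : ℕ} where

  Cover : Region k → List (Region k) → Set
  Cover R Rs = (z : Point k) → z ∈R R ⇔ Any (z ∈R_) Rs

  _⊆R_ : Region k → Region k → Set
  R′ ⊆R R = (z : Point k) → z ∈R R′ → z ∈R R

  above below level : Point k → ℤ → Region k → Region k
  above v n R = (v , n) ∷ R
  below v n R = (-ᵥ v , ℤ.- n) ∷ R
  level v n R = (v , ℤ.pred n) ∷ (-ᵥ v , ℤ.pred (ℤ.- n)) ∷ R

  below⇒< : ∀ {v n R z} → z ∈R below v n R → v · z ℤ.< n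
  below⇒< {v} {n} {R} {z} (h ∷ _) = ℤP.neg-cancel-< (≡.subst (ℤ.- n ℤ.<_) (·-negˡ v z) h)

  level⇒≡ : ∀ {v n R z} → z ∈R level v n R → v · z ≡ n
  level⇒≡ {v} {n} {R} {z} (h₁ ∷ h₂ ∷ _) =
    ℤP.≤-antisym (ℤP.neg-cancel-≤ (≡.subst (ℤ.- n ℤ.≤_) (·-negˡ v z) (pred<⇒≤ h₂))) (pred<⇒≤ h₁)

  sign-split : ∀ v n R → Cover R (above v n R ∷ below v n R ∷ level v n R ∷ [])
  sign-split v n R z = mk⇔ to from
    where
    to : z ∈R R → Any (z ∈R_) (above v n R ∷ below v n R ∷ level v n R ∷ [])
    to z∈R with ℤP.<-cmp n (v · z)
    ... | tri< n<vz _ _ = here (n<vz ∷ z∈R)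
    ... | tri> _ _ vz<n = there (here (≡.subst (ℤ.- n ℤ.<_) (≡.sym (·-negˡ v z)) (ℤP.neg-mono-< vz<n) ∷ z∈R))
    ... | tri≈ _ n≡vz _ = there (there (here (≡.subst (ℤ.pred n ℤ.<_) n≡vz (pred< n)
                          ∷ ≡.subst (ℤ.pred (ℤ.- n) ℤ.<_) (≡.trans (≡.cong ℤ.-_ n≡vz) (≡.sym (·-negˡ v z))) (pred< (ℤ.- n))
                          ∷ z∈R)))
    from : Any (z ∈R_) (above v n R ∷ below v n R ∷ level v n R ∷ []) → z ∈R R
    from (here (_ ∷ z∈R))                 = z∈R
    from (there (here (_ ∷ z∈R)))         = z∈R
    from (there (there (here (_ ∷ _ ∷ z∈R)))) = z∈R

  refine-union : ∀ {p q} {P : Region k → Set p} {Q : Region k → Set q} {Rs} → All P Rs →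
    (∀ {R′} → P R′ → Σ (List (Region k)) λ Rs′ → Cover R′ Rs′ × All Q Rs′) →
    Σ (List (Region k)) λ Rs′ → ((z : Point k) → Any (z ∈R_) Rs ⇔ Any (z ∈R_) Rs′) × All Q Rs′
  refine-union []         split = [] , (λ z → mk⇔ (λ ()) (λ ())) , []
  refine-union (pR ∷ pRs) split with split pR | refine-union pRs split
  ... | Rs′ , cover , qs | Rs″ , same , qs′ = Rs′ ++ Rs″ , (λ z → mk⇔ (to z) (from z)) , AllP.++⁺ qs qs′
    where
    to : ∀ z → Any (z ∈R_) (_ ∷ _) → Any (z ∈R_) (Rs′ ++ Rs″)
    to z (here z∈R)    = AnyP.++⁺ˡ (Equivalence.to (cover z) z∈R)
    to z (there z∈Rs)  = AnyP.++⁺ʳ Rs′ (Equivalence.to (same z) z∈Rs)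
    from : ∀ z → Any (z ∈R_) (Rs′ ++ Rs″) → Any (z ∈R_) (_ ∷ _)
    from z z∈ with AnyP.++⁻ Rs′ z∈
    ... | inj₁ z∈Rs′ = here (Equivalence.from (cover z) z∈Rs′)
    ... | inj₂ z∈Rs″ = there (Equivalence.from (same z) z∈Rs″)

  refine : ∀ {p q} {P : Region k → Set p} {Q : Region k → Set q} {R Rs} → Cover R Rs → All P Rs →
    (∀ {R′} → P R′ → Σ (List (Region k)) λ Rs′ → Cover R′ Rs′ × All Q Rs′) →
    Σ (List (Region k)) λ Rs′ → Cover R Rs′ × All Q Rs′
  refine cover ps split with refine-union ps split
  ... | Rs′ , same , qs = Rs′ , (λ z → ⇔.trans (cover z) (same z)) , qs


module Decomposition {c ℓ : Level} (F : Field c ℓ) {k : ℕ} (z₀ : Point k) where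
  open Field F
  open PolynomialArithmetic F using (_*ₚ_; shiftU; reflectU)
  open Products F using (GP-empty)
  open Runs F
  open import Algebra.Properties.CommutativeSemigroup *-commutativeSemigroup using (x∙yz≈y∙xz)

  -- (w, A, B) stands for the factorial term ∏_{j=1}^{w·z - w·z₀} A(j)/B(j).
  Run : Set c
  Run = Point k × UPoly F × UPoly F

  height : Point k → Point k → ℤ
  height w z = w · z ℤ.- w · z₀

  height-≡ : ∀ v z → height v z ≡ z · v ℤ.- z₀ · v
  height-≡ v z = ≡.cong₂ ℤ._-_ (·-comm v z) (·-comm v z₀)

  height-neg : ∀ v z → height (-ᵥ v) z ≡ z₀ · v ℤ.- z · v
  height-neg v z = ≡.trans (≡.cong₂ ℤ._-_ (·-negˡ v z) (·-negˡ v z₀))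
                  (≡.trans (negate-difference (v · z) (v · z₀)) (≡.cong₂ ℤ._-_ (·-comm v z₀) (·-comm v z)))
    where
    negate-difference : ∀ x y → ℤ.- x ℤ.- ℤ.- y ≡ y ℤ.- x
    negate-difference = solve-∀

  runAt : Point k → Run → Carrier
  runAt z (w , A , B) = run (height w z) A B

  ValidAt : Point k → Run → Set ℓ
  ValidAt z (w , A , B) = ValidRun (height w z) A B

  GPAt : Point k → WFData F k → Carrier
  GPAt z (v , a , b) = GP F (z₀ · v) (z · v) (ratio F a b)

  NonVanishingAt : Point k → WFData F k → Set ℓ
  NonVanishingAt z (v , a , b) = NonVanishingBetween (z₀ · v) (z · v) a b

  keys : List Run → List (Point k)
  keys = List.map proj₁

  _≟ᵥ_ : (x y : Point k) → Dec (x ≡ y)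
  _≟ᵥ_ = VecP.≡-dec ℤ._≟_

  insert : Run → List Run → List Run
  insert t [] = t ∷ []
  insert (w , A , B) ((w′ , A′ , B′) ∷ W) with w ≟ᵥ w′
  ... | yes _ = (w′ , A *ₚ A′ , B *ₚ B′) ∷ W
  ... | no  _ = (w′ , A′ , B′) ∷ insert (w , A , B) W

  insert-keys : ∀ {p} (P : Point k → Set p) t W → P (proj₁ t) → All P (keys W) → All P (keys (insert t W))
  insert-keys P t [] pt [] = pt ∷ []
  insert-keys P (w , A , B) ((w′ , A′ , B′) ∷ W) pt (pw′ ∷ pW) with w ≟ᵥ w′
  ... | yes _ = pw′ ∷ pW
  ... | no  _ = pw′ ∷ insert-keys P (w , A , B) W pt pW

  insert-unique : ∀ t W → Unique (keys W) → Unique (keys (insert t W))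
  insert-unique t [] [] = [] ∷ []
  insert-unique (w , A , B) ((w′ , A′ , B′) ∷ W) (w′∉W ∷ unique) with w ≟ᵥ w′
  ... | yes _   = w′∉W ∷ unique
  ... | no  w≢w′ = insert-keys (λ x → ¬ (w′ ≡ x)) (w , A , B) W (λ w′≡w → w≢w′ (≡.sym w′≡w)) w′∉W
                 ∷ insert-unique (w , A , B) W unique

  insert-runAt : ∀ z t W → ValidAt z t → All (ValidAt z) W →
    (prodList F (runAt z) (insert t W) ≈ runAt z t * prodList F (runAt z) W) × All (ValidAt z) (insert t W)
  insert-runAt z t [] valid [] = refl , valid ∷ []
  insert-runAt z (w , A , B) ((w′ , A′ , B′) ∷ W) valid (valid′ ∷ valids) with w ≟ᵥ w′
  ... | yes ≡.refl =
    trans (*-congʳ (run-*ₚ (height w z) (proj₂ valid) (proj₂ valid′))) (*-assoc _ _ _) ,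
    ValidRun-*ₚ valid valid′ ∷ valids
  ... | no _ with insert-runAt z (w , A , B) W valid valids
  ...   | eq , valids′ =
    trans (*-congˡ eq) (x∙yz≈y∙xz _ _ _) ,
    valid′ ∷ valids′

  record FactorialOn (V : List (WFData F k)) (R′ : Region k) : Set (c ⊔ ℓ) where
    constructor factorialOn
    field
      runs   : List Run
      unique : Unique (keys runs)
      agrees : (z : Point k) → z ∈R R′ →
               (prodList F (GPAt z) V ≈ prodList F (runAt z) runs) × All (ValidAt z) runs

  FactorialOn-⊆ : ∀ {V R R′} → R′ ⊆R R → FactorialOn V R → FactorialOn V R′
  FactorialOn-⊆ R′⊆R (factorialOn W unique eq) = factorialOn W unique λ z z∈R′ → eq z (R′⊆R z z∈R′)

  FactorialOn-∷-run : ∀ {t V R′} t′ → FactorialOn V R′ →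
    ((z : Point k) → z ∈R R′ → GPAt z t ≈ runAt z t′ × ValidAt z t′) → FactorialOn (t ∷ V) R′
  FactorialOn-∷-run t′ (factorialOn W unique eq) factor =
    factorialOn (insert t′ W) (insert-unique t′ W unique) λ z z∈R′ →
      let eqV , valids = eq z z∈R′
          eqt , valid = factor z z∈R′
          eqW , valids′ = insert-runAt z t′ W valid valids
      in trans (*-cong eqt eqV) (sym eqW) , valids′

  FactorialOn-∷-one : ∀ {t V R′} → FactorialOn V R′ →
    ((z : Point k) → z ∈R R′ → GPAt z t ≈ 1#) → FactorialOn (t ∷ V) R′
  FactorialOn-∷-one (factorialOn W unique eq) factor =
    factorialOn W unique λ z z∈R′ →
      trans (*-congʳ (factor z z∈R′)) (trans (*-identityˡ _) (proj₁ (eq z z∈R′))) , proj₂ (eq z z∈R′)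

  extend : ∀ t V R′ → FactorialOn V R′ → ((z : Point k) → z ∈R R′ → NonVanishingAt z t) →
    Σ (List (Region k)) λ Rs → Cover R′ Rs × All (λ R″ → R″ ⊆R R′ × FactorialOn (t ∷ V) R″) Rs
  extend (v , a , b) V R′ fp nv = _ , sign-split v n R′ ,
    (drop₁ , FactorialOn-∷-run (v , a↑ , b↑) (FactorialOn-⊆ drop₁ fp) ascending) ∷
    (drop₁ , FactorialOn-∷-run (-ᵥ v , b↓ , a↓) (FactorialOn-⊆ drop₁ fp) descending) ∷
    (drop₂ , FactorialOn-∷-one (FactorialOn-⊆ drop₂ fp) empty) ∷ []
    where
    n = v · z₀
    a↑ = shiftU a (z₀ · v ℤ.- + 1)
    b↑ = shiftU b (z₀ · v ℤ.- + 1)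
    a↓ = reflectU a (z₀ · v)
    b↓ = reflectU b (z₀ · v)
    drop₁ : ∀ {h} → (h ∷ R′) ⊆R R′
    drop₁ z (_ ∷ z∈R′) = z∈R′
    drop₂ : ∀ {h h′} → (h ∷ h′ ∷ R′) ⊆R R′
    drop₂ z (_ ∷ _ ∷ z∈R′) = z∈R′
    FactorIsRun : Point k → ℤ → UPoly F → UPoly F → Set ℓ
    FactorIsRun z L A B = GPAt z (v , a , b) ≈ run L A B × ValidRun L A B
    ascending : ∀ z → z ∈R above v n R′ → FactorIsRun z (height v z) a↑ b↑
    ascending z (n<vz ∷ z∈R′) = ≡.subst (λ L → FactorIsRun z L a↑ b↑) (≡.sym (height-≡ v z))
      (GP-ratio-ascending a b (≡.subst₂ ℤ._<_ (·-comm v z₀) (·-comm v z) n<vz) (nv z z∈R′))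
    descending : ∀ z → z ∈R below v n R′ → FactorIsRun z (height (-ᵥ v) z) b↓ a↓
    descending z z∈ = ≡.subst (λ L → FactorIsRun z L b↓ a↓) (≡.sym (height-neg v z))
      (GP-ratio-descending a b (≡.subst₂ ℤ._<_ (·-comm v z) (·-comm v z₀) (below⇒< {v = v} z∈)) (nv z (drop₁ z z∈)))
    empty : ∀ z → z ∈R level v n R′ → GPAt z (v , a , b) ≈ 1#
    empty z z∈ = ≡.subst₂ (λ p q → GP F p q (ratio F a b) ≈ 1#)
      (·-comm v z₀) (≡.trans (≡.sym (level⇒≡ {v = v} z∈)) (·-comm v z)) (GP-empty n (ratio F a b))

  factorial-cover : ∀ V R → ((z : Point k) → z ∈R R → All (NonVanishingAt z) V) →
    Σ (List (Region k)) λ Rs → Cover R Rs × All (λ R′ → R′ ⊆R R × FactorialOn V R′) Rs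
  factorial-cover [] R _ =
    (R ∷ []) , (λ z → mk⇔ here λ { (here z∈R) → z∈R ; (there ()) }) ,
    ((λ _ z∈R → z∈R) , factorialOn [] [] λ _ _ → refl , []) ∷ []
  factorial-cover (t ∷ V) R nv with factorial-cover V R (λ z z∈R → All.tail (nv z z∈R))
  ... | Rs , cover , pieces = refine cover pieces λ { (R′⊆R , fp) →
    let Rs′ , cover′ , pieces′ = extend t V _ fp (λ z z∈R′ → All.head (nv z (R′⊆R z z∈R′)))
    in Rs′ , cover′ , All.map (λ { (R″⊆R′ , fp′) → (λ z z∈R″ → R′⊆R z (R″⊆R′ z z∈R″)) , fp′ }) pieces′ }

  toFData : Run → FData F k
  toFData (w , A , B) = w , A , B , ℤ.- (w · z₀)

  ValidAt⇒bounds : ∀ z w A B → ValidAt z (w , A , B) →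
    + 0 ℤ.< height w z × ((j : ℤ) → + 1 ℤ.≤ j → j ℤ.≤ height w z → ¬ (evalU F A j ≈ 0#) × ¬ (evalU F B j ≈ 0#))
  ValidAt⇒bounds z w A B (0<L , nz) = 0<L , window⇒range 0<L λ i i<m →
    let open NonVanishing (nz i i<m) in numerator , denominator

  factorial : ∀ {f : Point k → Carrier} {V R′} →
    ((z : Point k) → z ∈R R′ → f z ≈ prodList F (GPAt z) V) → FactorialOn V R′ → Factorial F f R′
  factorial weakly (factorialOn W unique eq) =
    List.map toFData W , ≡.subst Unique (ListP.map-∘ W) unique , λ z z∈R′ →
      trans (weakly z z∈R′) (trans (proj₁ (eq z z∈R′)) (reflexive (≡.sym (ListP.foldr-map _ toFData 1# W)))) ,
      AllP.map⁺ (All.map (λ { {w , A , B} → ValidAt⇒bounds z w A B }) (proj₂ (eq z z∈R′)))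

lemmaB25 : ∀ {c ℓ : Level} (F : Field c ℓ) (k : ℕ) (f : Point k → Field.Carrier F) →
    Hypergeometric F f → (R : Region k) → WeaklyFactorial F f R →
    Σ (List (Region k)) λ Rs →
    ((z : Point k) → (z ∈R R) ⇔ Any (λ Rᵢ → z ∈R Rᵢ) Rs) × All (Factorial F f) Rs
lemmaB25 F k f _ R (V , _ , z₀ , _ , weakly) =
  let Rs , cover , pieces = factorial-cover V R (λ z z∈R → proj₂ (weakly z z∈R))
  in Rs , cover , All.map (λ { (R′⊆R , fp) → factorial (λ z z∈R′ → proj₁ (weakly z (R′⊆R z z∈R′))) fp }) pieces
  where open Decomposition F z₀
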